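{- For $i=1,2$, let $H_i$ be a finite simple graph of odd order with a uniquely unmatched vertex $v_i$, let $k_i=(|V(H_i)|-1)/2$, and let $M_{v_i}$ be the unique near-perfect matching of $H_i$ with $v_i$ unmatched (a vertex of $\mathcal{M}_{k_i}(H_i)$). Then \[\mathcal{M}_{k_1+k_2}\bigl((H_1\sqcup H_2)/(v_1\sim v_2)\bigr)\cong \bigl(\mathcal{M}_{k_1}(H_1)\sqcup\mathcal{M}_{k_2}(H_2)\bigr)/(M_{v_1}\sim M_{v_2}).\]
   Context: For a matching $M\subseteq E(G)$, $G\langle M\rangle$ denotes the spanning subgraph of $G$ with edge set $M$. The matching reconfiguration graph $\mathcal{M}_k(G)$ has as vertices all matchings of $G$ of size at least $k$; distinct matchings $M_1,M_2$ are adjacent iff there is $v\in V(G)$ with $G\langle M_1\rangle-v=G\langle M_2\rangle-v$. For a graph of order $2k+1$, the vertices of $\mathcal{M}_k$ are its near-perfect matchings (matchings of size $k$, leaving exactly one vertex unmatched). In a graph $G$ of order $2k+1$, a vertex $v$ is uniquely unmatched if $G-v$ has exactly one perfect matching. For graphs $A,B$ and vertices $a\in V(A)$, $b\in V(B)$, $(A\sqcup B)/(a\sim b)$ denotes the graph obtained from the disjoint union of $A$ and $B$ by identifying $a$ and $b$ into a single vertex. -}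

module Defs where

open import Data.Nat using (ℕ; zero; suc; _+_; _*_; _≤_)
open import Data.Bool using (Bool; true; false; _∧_; _∨_; if_then_else_)
open import Data.Fin using (Fin; splitAt; punchIn; _<?_; _≟_)
open import Data.List using (List; map; allFin)
open import Data.Nat.ListAction using (sum)
open import Data.Maybe using (Maybe; just; nothing)
open import Data.Product using (Σ; _×_; _,_; ∃)
open import Data.Sum using (_⊎_; inj₁; inj₂)
open import Relation.Nullary using (¬_; does)
open import Relation.Binary using (IsEquivalence)
open import Relation.Binary.PropositionalEquality using (_≡_; _≢_)

Adjacency : ℕ → Set
Adjacency n = Fin n → Fin n → Bool

record IsSimple {n : ℕ} (adj : Adjacency n) : Set where
  field
    symmetric   : ∀ x y → adj x y ≡ adj y x
    irreflexive : ∀ x → adj x x ≡ false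

delete : {n : ℕ} → Adjacency (suc n) → Fin (suc n) → Adjacency n
delete adj v x y = adj (punchIn v x) (punchIn v y)

record IsMatching {n : ℕ} (adj : Adjacency n) (M : Fin n → Fin n → Bool) : Set where
  field
    sub       : ∀ x y → M x y ≡ true → adj x y ≡ true
    symmetric : ∀ x y → M x y ≡ M y x
    disjoint  : ∀ x y z → M x y ≡ true → M x z ≡ true → y ≡ z

size : {n : ℕ} → (Fin n → Fin n → Bool) → ℕ
size {n} M = sum (map (λ x → sum (map (λ y → if does (x <? y) ∧ M x y then 1 else 0) (allFin n))) (allFin n))

IsPerfectMatching : {n : ℕ} → Adjacency n → (Fin n → Fin n → Bool) → Set
IsPerfectMatching {n} adj M = IsMatching adj M × (∀ x → ∃ λ y → M x y ≡ true)

_≐_ : {n : ℕ} → (Fin n → Fin n → Bool) → (Fin n → Fin n → Bool) → Set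
M ≐ N = ∀ x y → M x y ≡ N x y

HasUniquePerfectMatching : {n : ℕ} → Adjacency n → Set
HasUniquePerfectMatching adj =
  Σ _ λ M → IsPerfectMatching adj M × (∀ N → IsPerfectMatching adj N → N ≐ M)

UniquelyUnmatched : {n : ℕ} → Adjacency (suc n) → Fin (suc n) → Set
UniquelyUnmatched adj v = HasUniquePerfectMatching (delete adj v)

Unmatched : {n : ℕ} → (Fin n → Fin n → Bool) → Fin n → Set
Unmatched M v = ∀ y → M v y ≡ false

record SGraph : Set₁ where
  field
    V       : Set
    _≈_     : V → V → Set
    isEquiv : IsEquivalence _≈_
    E       : V → V → Set

open SGraph

record _≅_ (G H : SGraph) : Set where
  field
    to        : V G → V H
    from      : V H → V G
    to-cong   : ∀ {x y} → _≈_ G x y → _≈_ H (to x) (to y)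
    from-cong : ∀ {x y} → _≈_ H x y → _≈_ G (from x) (from y)
    from-to   : ∀ x → _≈_ G (from (to x)) x
    to-from   : ∀ y → _≈_ H (to (from y)) y
    E-to      : ∀ x y → E G x y → E H (to x) (to y)
    E-from    : ∀ x y → E H (to x) (to y) → E G x y

MVertex : {n : ℕ} → Adjacency n → ℕ → Set
MVertex adj k = Σ _ λ M → IsMatching adj M × (k ≤ size M)

MatchingGraph : {n : ℕ} → ℕ → Adjacency n → SGraph
MatchingGraph {n} k adj = record
  { V = MVertex adj k
  ; _≈_ = λ { (M , _) (N , _) → M ≐ N }
  ; isEquiv = record
      { refl  = λ x y → Relation.Binary.PropositionalEquality.refl
      ; sym   = λ p x y → Relation.Binary.PropositionalEquality.sym (p x y)
      ; trans = λ p q x y → Relation.Binary.PropositionalEquality.trans (p x y) (q x y)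
      }
  ; E = λ { (M , _) (N , _) → ¬ (M ≐ N) ×
            (∃ λ (v : Fin n) → ∀ x y → x ≢ v → y ≢ v → M x y ≡ N x y) }
  }

module _ (A B : SGraph) (a : V A) (b : V B) where
  private
    module A = SGraph A
    module B = SGraph B
    module EA = IsEquivalence A.isEquiv
    module EB = IsEquivalence B.isEquiv

    R : A.V ⊎ B.V → A.V ⊎ B.V → Set
    R (inj₁ x) (inj₁ y) = A._≈_ x y
    R (inj₂ x) (inj₂ y) = B._≈_ x y
    R (inj₁ x) (inj₂ y) = A._≈_ x a × B._≈_ y b
    R (inj₂ x) (inj₁ y) = B._≈_ x b × A._≈_ y a

    R-refl : ∀ {p} → R p p
    R-refl {inj₁ x} = EA.refl
    R-refl {inj₂ x} = EB.refl

    R-sym : ∀ {p q} → R p q → R q p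
    R-sym {inj₁ x} {inj₁ y} r = EA.sym r
    R-sym {inj₂ x} {inj₂ y} r = EB.sym r
    R-sym {inj₁ x} {inj₂ y} (r , s) = s , r
    R-sym {inj₂ x} {inj₁ y} (r , s) = s , r

    R-trans : ∀ {p q r} → R p q → R q r → R p r
    R-trans {inj₁ x} {inj₁ y} {inj₁ z} s t = EA.trans s t
    R-trans {inj₁ x} {inj₁ y} {inj₂ z} s (t , u) = EA.trans s t , u
    R-trans {inj₁ x} {inj₂ y} {inj₁ z} (s , t) (u , w) = EA.trans s (EA.sym w)
    R-trans {inj₁ x} {inj₂ y} {inj₂ z} (s , t) u = s , EB.trans (EB.sym u) t
    R-trans {inj₂ x} {inj₁ y} {inj₁ z} (s , t) u = s , EA.trans (EA.sym u) t
    R-trans {inj₂ x} {inj₁ y} {inj₂ z} (s , t) (u , w) = EB.trans s (EB.sym w)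
    R-trans {inj₂ x} {inj₂ y} {inj₁ z} s (t , u) = EB.trans s t , u
    R-trans {inj₂ x} {inj₂ y} {inj₂ z} s t = EB.trans s t

    E⊔ : A.V ⊎ B.V → A.V ⊎ B.V → Set
    E⊔ (inj₁ x) (inj₁ y) = A.E x y
    E⊔ (inj₂ x) (inj₂ y) = B.E x y
    E⊔ _ _ = Data.Empty.⊥
      where import Data.Empty

  -- vertices: disjoint union, with a and b identified; two classes are
  -- adjacent iff some representatives are adjacent in A ⊔ B.
  Wedge : SGraph
  Wedge = record
    { V = A.V ⊎ B.V
    ; _≈_ = R
    ; isEquiv = record { refl = λ {p} → R-refl {p} ; sym = λ {p} {q} → R-sym {p} {q}
                      ; trans = λ {p} {q} {r} → R-trans {p} {q} {r} }
    ; E = λ p q → Σ _ λ u → Σ _ λ w → R p u × R q w × E⊔ u w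
    }

-- Vertex set Fin (m + n): the first m vertices are those of H₁, the last n are
-- the vertices of H₂ other than v₂ (in order, via punchIn v₂); v₂ is v₁.

module _ {m n : ℕ} (H₁ : Adjacency m) (v₁ : Fin m)
                   (H₂ : Adjacency (suc n)) (v₂ : Fin (suc n)) where
  private
    part₁ : Fin (m + n) → Maybe (Fin m)
    part₁ w with splitAt m w
    ... | inj₁ x = just x
    ... | inj₂ _ = nothing

    part₂ : Fin (m + n) → Maybe (Fin (suc n))
    part₂ w with splitAt m w
    ... | inj₁ x = if does (x ≟ v₁) then just v₂ else nothing
    ... | inj₂ y = just (punchIn v₂ y)

    adjM : {k : ℕ} → Adjacency k → Maybe (Fin k) → Maybe (Fin k) → Bool
    adjM G (just x) (just y) = G x y
    adjM G _ _ = false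

  glue : Adjacency (m + n)
  glue w w' = adjM H₁ (part₁ w) (part₁ w') ∨ adjM H₂ (part₂ w) (part₂ w')

{-# OPTIONS --safe #-}
module Submission where

-- A matching M of the wedge with at most one unmatched vertex restricts to matchings of H₁
-- and H₂, and the glued vertex is matched into at most one side. On a side where it is not,
-- say H₁, the restriction leaves at most one vertex of the even-order graph H₁ - v₁
-- unmatched, hence matches it perfectly, so it is M_{v₁} because v₁ is uniquely unmatched.
-- Thus M = M_{v₁} ⊕ N with N a near-perfect matching of H₂, or symmetrically, and the two
-- descriptions meet exactly in M_{v₁} ⊕ M_{v₂}. Adjacency is compared side by side: if
-- A ⊕ M_{v₂} and M_{v₁} ⊕ B agree off one vertex, then A agrees with M_{v₁} off v₁ or B
-- agrees with M_{v₂} off v₂, and a matching that leaves only vᵢ unmatched is determined by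
-- its edges off vᵢ.

open import Defs
open import Data.Nat using (ℕ; zero; suc; _+_; _*_; _∸_; _≤_; z≤n; s≤s)
open import Data.Nat.Properties
  using (≤-trans; ≤-reflexive; m≤m+n; m≤n+m; +-identityʳ; +-mono-≤; +-monoˡ-≤; +-monoʳ-≤;
         +-cancelˡ-≤; +-cancelʳ-≤; *-cancelˡ-≤; *-monoʳ-≤; +-comm; m+[n∸m]≡n; m∸n≤m; 1+n≰n;
         even≢odd; m≤n⇒m∸n≡0; *-distribˡ-+; +-0-commutativeMonoid)
open import Data.Nat.ListAction using (sum)
open import Data.Bool using (Bool; true; false; _∧_; if_then_else_)
open import Data.Bool.Properties using (⇔→≡; ∨-zeroʳ; ¬-not)
open import Data.Fin using (Fin; zero; suc; _<?_; punchIn; punchOut; _≟_; _↑ˡ_; _↑ʳ_; splitAt)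
open import Data.Fin.Properties
  using (<-cmp; <-asym; <-irrefl; suc-injective; punchIn-injective; punchIn-punchOut; punchOut-punchIn; punchOut-cong; punchInᵢ≢i; any?;
         ↑ˡ-injective; ↑ʳ-injective; splitAt-↑ˡ; splitAt-↑ʳ; splitAt⁻¹-↑ˡ; splitAt⁻¹-↑ʳ)
open import Data.List as List using (allFin; tabulate)
open import Data.List.Properties using (map-tabulate)
import Data.Product
import Data.Sum
open import Data.Product using (Σ; ∃; ∃₂; _×_; _,_; proj₁; proj₂)
open import Data.Sum using (_⊎_; inj₁; inj₂)
open import Data.Empty using (⊥; ⊥-elim)
open import Function using (_∘_; flip; _⇔_; mk⇔; Injective; Equivalence)
open Equivalence using (to; from)
open import Relation.Nullary using (¬_; does; yes; no; contradiction)
open import Relation.Nullary.Decidable using (dec-true; dec-false)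
open import Relation.Binary using (tri<; tri≈; tri>; IsEquivalence)
open import Relation.Binary.PropositionalEquality
open import Algebra.Properties.CommutativeMonoid.Sum +-0-commutativeMonoid
  using (sum-syntax; ∑-distrib-+; ∑-comm; sum-cong-≗; sum-replicate-zero)
  renaming (sum to ∑)

AtMostOne : ∀ {n} → (Fin n → Set) → Set
AtMostOne P = ∀ i j → P i → P j → i ≡ j

AtMostOneUnmatched : ∀ {n} → Adjacency n → Set
AtMostOneUnmatched M = AtMostOne (Unmatched M)

Loopless : ∀ {n} → Adjacency n → Set
Loopless M = ∀ x → M x x ≡ false

IsPerfect : ∀ {n} → Adjacency n → Set
IsPerfect M = ∀ x → ∃ λ y → M x y ≡ true

restrict : ∀ {p r} → (Fin p → Fin r) → Adjacency r → Adjacency p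
restrict f M x y = M (f x) (f y)

AgreeOff : ∀ {n} → Adjacency n → Adjacency n → Fin n → Set
AgreeOff M N v = ∀ x y → x ≢ v → y ≢ v → M x y ≡ N x y

Adjacent : ∀ {n} → Adjacency n → Adjacency n → Set
Adjacent M N = ¬ (M ≐ N) × ∃ (AgreeOff M N)

≐-refl : ∀ {n} {M : Adjacency n} → M ≐ M
≐-refl x y = refl

≐-sym : ∀ {n} {M N : Adjacency n} → M ≐ N → N ≐ M
≐-sym M≐N x y = sym (M≐N x y)

≐-trans : ∀ {n} {M N P : Adjacency n} → M ≐ N → N ≐ P → M ≐ P
≐-trans M≐N N≐P x y = trans (M≐N x y) (N≐P x y)

true≢false : true ≢ false
true≢false ()

punchIn-view : ∀ {n} (v z : Fin (suc n)) → z ≡ v ⊎ ∃ λ y → z ≡ punchIn v y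
punchIn-view v z with z ≟ v
... | yes z≡v = inj₁ z≡v
... | no z≢v  = inj₂ (punchOut (z≢v ∘ sym) , sym (punchIn-punchOut (z≢v ∘ sym)))

matched-or-unmatched : ∀ {n} (M : Adjacency n) x → (∃ λ y → M x y ≡ true) ⊎ Unmatched M x
matched-or-unmatched M x with any? (λ y → M x y Data.Bool.≟ true)
... | yes matched = inj₁ matched
... | no ¬matched = inj₂ λ y → ¬-not λ e → ¬matched (y , e)

matching-loopless : ∀ {n} {H M : Adjacency n} → IsMatching H M → Loopless H → Loopless M
matching-loopless {M = M} isMatching H-loopless x with M x x in e
... | false = refl
... | true  = ⊥-elim (true≢false (trans (sym (IsMatching.sub isMatching x x e)) (H-loopless x)))

AgreeOff-resp : ∀ {n} {M M' N N' : Adjacency n} {v} → M ≐ M' → N ≐ N' → AgreeOff M N v → AgreeOff M' N' v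
AgreeOff-resp M≐M' N≐N' agree x y x≢v y≢v = trans (sym (M≐M' x y)) (trans (agree x y x≢v y≢v) (N≐N' x y))

Adjacent-resp : ∀ {n} {M M' N N' : Adjacency n} → M ≐ M' → N ≐ N' → Adjacent M N → Adjacent M' N'
Adjacent-resp M≐M' N≐N' (M≢N , v , agree) =
  (λ M'≐N' → M≢N (≐-trans M≐M' (≐-trans M'≐N' (≐-sym N≐N')))) , v , AgreeOff-resp M≐M' N≐N' agree

AgreeOff-sym : ∀ {n} {M N : Adjacency n} {v} → AgreeOff M N v → AgreeOff N M v
AgreeOff-sym agree x y x≢v y≢v = sym (agree x y x≢v y≢v)

Adjacent-sym : ∀ {n} {M N : Adjacency n} → Adjacent M N → Adjacent N M
Adjacent-sym (M≢N , v , agree) = (λ N≐M → M≢N (≐-sym N≐M)) , v , AgreeOff-sym agree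

AgreeOff-restrict : ∀ {p r} {f : Fin p → Fin r} {M N w x} →
  (∀ x' → f x' ≡ w → x' ≡ x) → AgreeOff M N w → AgreeOff (restrict f M) (restrict f N) x
AgreeOff-restrict only-x agree a b a≢x b≢x = agree _ _ (a≢x ∘ only-x a) (b≢x ∘ only-x b)

module _ {p r} {f : Fin p → Fin r} (f-injective : Injective _≡_ _≡_ f) where

  restrict-isMatching : ∀ {H H' M} → restrict f H' ≐ H → IsMatching H' M → IsMatching H (restrict f M)
  restrict-isMatching H'≐H isMatching = record
    { sub       = λ x y e → trans (sym (H'≐H x y)) (sub (f x) (f y) e)
    ; symmetric = λ x y → symmetric (f x) (f y)
    ; disjoint  = λ x y z e e' → f-injective (disjoint (f x) (f y) (f z) e e')
    }
    where open IsMatching isMatching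

  AtMostOneUnmatched-restrict : ∀ {M} → (∀ x → Unmatched (restrict f M) x → Unmatched M (f x)) →
    AtMostOneUnmatched M → AtMostOneUnmatched (restrict f M)
  AtMostOneUnmatched-restrict unmatched-f amo x y ux uy = f-injective (amo _ _ (unmatched-f x ux) (unmatched-f y uy))

AtMostOneUnmatched-extend : ∀ {p r} {f : Fin p → Fin r} {M} → (∀ w → Unmatched M w → ∃ λ x → w ≡ f x) →
  AtMostOneUnmatched (restrict f M) → AtMostOneUnmatched M
AtMostOneUnmatched-extend {f = f} in-image amo w w' uw uw' with in-image w uw | in-image w' uw'
... | x , refl | x' , refl = cong f (amo x x' (λ y → uw (f y)) (λ y → uw' (f y)))

module _ {n} {H M : Adjacency (suc n)} (isMatching : IsMatching H M) {v} (unmatched : Unmatched M v) where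
  open IsMatching isMatching

  delete-isMatching : IsMatching (delete H v) (delete M v)
  delete-isMatching = restrict-isMatching (punchIn-injective v _ _) ≐-refl isMatching

  unmatched-delete : ∀ {x} → Unmatched (delete M v) x → Unmatched M (punchIn v x)
  unmatched-delete ux z with punchIn-view v z
  ... | inj₁ refl       = trans (symmetric _ _) (unmatched _)
  ... | inj₂ (y , refl) = ux y

  AtMostOneUnmatched-delete : AtMostOneUnmatched M → AtMostOneUnmatched (delete M v)
  AtMostOneUnmatched-delete = AtMostOneUnmatched-restrict (punchIn-injective v _ _) λ _ → unmatched-delete

AgreeOff-unmatched⇒≐ : ∀ {n} {M N : Adjacency n} {v} → (∀ x y → M x y ≡ M y x) → (∀ x y → N x y ≡ N y x) →
  Unmatched M v → Unmatched N v → AgreeOff M N v → M ≐ N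
AgreeOff-unmatched⇒≐ {v = v} M-symmetric N-symmetric M-unmatched N-unmatched agree x y with x ≟ v | y ≟ v
... | yes refl | _        = trans (M-unmatched y) (sym (N-unmatched y))
... | no _     | yes refl = trans (M-symmetric x v) (trans (M-unmatched x) (sym (trans (N-symmetric x v) (N-unmatched x))))
... | no x≢v   | no y≢v   = agree x y x≢v y≢v

delete-≐⇒AgreeOff : ∀ {n} {M N : Adjacency (suc n)} {v} → delete M v ≐ delete N v → AgreeOff M N v
delete-≐⇒AgreeOff {v = v} M≐N x y x≢v y≢v with punchIn-view v x | punchIn-view v y
... | inj₁ x≡v         | _                = ⊥-elim (x≢v x≡v)
... | _                | inj₁ y≡v         = ⊥-elim (y≢v y≡v)
... | inj₂ (x' , refl) | inj₂ (y' , refl) = M≐N x' y'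

AtMostOneUnmatched-resp : ∀ {n} {M N : Adjacency n} → M ≐ N → AtMostOneUnmatched M → AtMostOneUnmatched N
AtMostOneUnmatched-resp M≐N amo x y ux uy = amo x y (λ z → trans (M≐N x z) (ux z)) (λ z → trans (M≐N y z) (uy z))

module _ {n} {H M N : Adjacency n} (H-loopless : Loopless H) (M-matching : IsMatching H M) (N-matching : IsMatching H N)
         (amo : AtMostOneUnmatched M) {v} (unmatched : Unmatched M v) (agree : AgreeOff M N v) where
  private
    module M = IsMatching M-matching
    module N = IsMatching N-matching

    endpoint≢v : ∀ {z} → N v z ≡ true → z ≢ v
    endpoint≢v e refl = true≢false (trans (sym e) (matching-loopless N-matching H-loopless v))

    -- M matches z ≠ v to some z' ≠ v, and N contains the edge z z' as well.
    no-edge-at-v : ∀ {z} → N v z ≡ true → ⊥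
    no-edge-at-v {z} e with matched-or-unmatched M z
    ... | inj₂ z-unmatched = endpoint≢v e (amo z v z-unmatched unmatched)
    ... | inj₁ (z' , e') = z'≢v (sym (N.disjoint z v z' (trans (N.symmetric z v) e) (trans (sym (agree z z' (endpoint≢v e) z'≢v)) e')))
      where
      z'≢v : z' ≢ v
      z'≢v refl = true≢false (trans (sym e') (trans (M.symmetric z v) (unmatched z)))

    N-unmatched : Unmatched N v
    N-unmatched z with N v z in e
    ... | false = refl
    ... | true  = ⊥-elim (no-edge-at-v e)

  AgreeOff⇒≐ : N ≐ M
  AgreeOff⇒≐ = AgreeOff-unmatched⇒≐ N.symmetric M.symmetric N-unmatched unmatched (AgreeOff-sym agree)

-- Counting unmatched vertices

indicator : Bool → ℕ
indicator b = if b then 1 else 0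

degree : ∀ {n} → Adjacency n → Fin n → ℕ
degree {n} M x = ∑[ y < n ] indicator (M x y)

unmatchedCount : ∀ {n} → Adjacency n → ℕ
unmatchedCount {n} M = ∑[ x < n ] (1 ∸ degree M x)

≤-∑ : ∀ {n} (f : Fin n → ℕ) i → f i ≤ ∑ f
≤-∑ f zero    = m≤m+n _ _
≤-∑ f (suc i) = ≤-trans (≤-∑ (f ∘ suc) i) (m≤n+m _ _)

∑≤1⇒AtMostOne : ∀ {n} (f : Fin n → ℕ) → ∑ f ≤ 1 → AtMostOne (λ i → 1 ≤ f i)
∑≤1⇒AtMostOne f ∑≤1 zero    zero    _ _ = refl
∑≤1⇒AtMostOne f ∑≤1 zero    (suc j) p q =
  ⊥-elim (1+n≰n (≤-trans (+-mono-≤ p (≤-trans q (≤-∑ (f ∘ suc) j))) ∑≤1))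
∑≤1⇒AtMostOne f ∑≤1 (suc i) zero    p q =
  ⊥-elim (1+n≰n (≤-trans (+-mono-≤ q (≤-trans p (≤-∑ (f ∘ suc) i))) ∑≤1))
∑≤1⇒AtMostOne f ∑≤1 (suc i) (suc j) p q =
  cong suc (∑≤1⇒AtMostOne (f ∘ suc) (≤-trans (m≤n+m _ (f zero)) ∑≤1) i j p q)

AtMostOne⇒∑≤1 : ∀ {n} (f : Fin n → ℕ) → (∀ i → f i ≤ 1) → AtMostOne (λ i → 1 ≤ f i) → ∑ f ≤ 1
AtMostOne⇒∑≤1 {zero}  f f≤1 atMostOne = z≤n
AtMostOne⇒∑≤1 {suc n} f f≤1 atMostOne with f zero in f₀
... | zero  = AtMostOne⇒∑≤1 (f ∘ suc) (f≤1 ∘ suc) λ i j p q → suc-injective (atMostOne (suc i) (suc j) p q)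
... | suc k = begin
  suc k + ∑ (f ∘ suc) ≡⟨ cong (suc k +_) (trans (sum-cong-≗ tail≡0) (sum-replicate-zero n)) ⟩
  suc k + 0           ≡⟨ +-identityʳ (suc k) ⟩
  suc k               ≤⟨ subst (_≤ 1) f₀ (f≤1 zero) ⟩
  1                   ∎
  where
  open Data.Nat.Properties.≤-Reasoning
  tail≡0 : ∀ i → f (suc i) ≡ 0
  tail≡0 i with f (suc i) in fᵢ
  ... | zero  = refl
  ... | suc _ with atMostOne zero (suc i) (subst (1 ≤_) (sym f₀) (s≤s z≤n)) (subst (1 ≤_) (sym fᵢ) (s≤s z≤n))
  ... | ()

sum-tabulate : ∀ {n} (f : Fin n → ℕ) → sum (tabulate f) ≡ ∑ f
sum-tabulate {zero}  f = refl
sum-tabulate {suc n} f = cong (f zero +_) (sum-tabulate (f ∘ suc))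

sum-map-allFin : ∀ {n} (f : Fin n → ℕ) → sum (List.map f (allFin n)) ≡ ∑ f
sum-map-allFin f = trans (cong sum (map-tabulate (λ x → x) f)) (sum-tabulate f)

size≡∑ : ∀ {n} (M : Adjacency n) → size M ≡ ∑[ x < n ] ∑[ y < n ] indicator (does (x <? y) ∧ M x y)
size≡∑ {n} M = trans (sum-map-allFin row) (sum-cong-≗ λ x → sum-map-allFin (λ y → indicator (does (x <? y) ∧ M x y)))
  where
  row : Fin n → ℕ
  row x = sum (List.map (λ y → indicator (does (x <? y) ∧ M x y)) (allFin n))

module _ {n} {M : Adjacency n} (symmetric : ∀ x y → M x y ≡ M y x) (loopless : Loopless M) where

  private
    upper : Fin n → Fin n → ℕ
    upper x y = indicator (does (x <? y) ∧ M x y)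

    indicator-split : ∀ x y → indicator (M x y) ≡ upper x y + upper y x
    indicator-split x y with <-cmp x y
    ... | tri< x<y _ _ rewrite dec-true (x <? y) x<y | dec-false (y <? x) (<-asym x<y) = sym (+-identityʳ _)
    ... | tri≈ _ refl _ rewrite dec-false (x <? x) (<-irrefl refl) | loopless x = refl
    ... | tri> _ _ y<x rewrite dec-false (x <? y) (<-asym y<x) | dec-true (y <? x) y<x = cong indicator (symmetric x y)

  ∑-degree≡2*size : ∑ (degree M) ≡ 2 * size M
  ∑-degree≡2*size = begin
    ∑[ x < n ] ∑[ y < n ] indicator (M x y)                        ≡⟨ sum-cong-≗ (λ x → sum-cong-≗ (indicator-split x)) ⟩
    ∑[ x < n ] ∑[ y < n ] (upper x y + upper y x)                  ≡⟨ sum-cong-≗ (λ x → ∑-distrib-+ (upper x) (λ y → upper y x)) ⟩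
    ∑[ x < n ] (∑ (upper x) + ∑[ y < n ] upper y x)                ≡⟨ ∑-distrib-+ (∑ ∘ upper) _ ⟩
    ∑[ x < n ] ∑ (upper x) + ∑[ x < n ] ∑[ y < n ] upper y x       ≡⟨ cong (∑ (∑ ∘ upper) +_) (∑-comm (λ x y → upper y x)) ⟩
    ∑[ x < n ] ∑ (upper x) + ∑[ x < n ] ∑ (upper x)                ≡⟨ cong (λ s → s + s) (sym (size≡∑ M)) ⟩
    size M + size M                                                ≡⟨ cong (size M +_) (sym (+-identityʳ (size M))) ⟩
    2 * size M                                                     ∎
    where open ≡-Reasoning

module _ {n} {H M : Adjacency n} (isMatching : IsMatching H M) where
  open IsMatching isMatching

  degree≤1 : ∀ x → degree M x ≤ 1
  degree≤1 x = AtMostOne⇒∑≤1 _ (λ y → indicator≤1 (M x y))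
    λ y z p q → disjoint x y z (indicator-true p) (indicator-true q)
    where
    indicator≤1 : ∀ b → indicator b ≤ 1
    indicator≤1 true  = s≤s z≤n
    indicator≤1 false = z≤n
    indicator-true : ∀ {b} → 1 ≤ indicator b → b ≡ true
    indicator-true {true} _ = refl

  2*size+unmatchedCount≡n : Loopless H → 2 * size M + unmatchedCount M ≡ n
  2*size+unmatchedCount≡n H-loopless = begin
    2 * size M + unmatchedCount M                 ≡⟨ cong (_+ unmatchedCount M) (sym (∑-degree≡2*size symmetric (matching-loopless isMatching H-loopless))) ⟩
    ∑ (degree M) + unmatchedCount M               ≡⟨ sym (∑-distrib-+ (degree M) _) ⟩
    ∑[ x < n ] (degree M x + (1 ∸ degree M x))   ≡⟨ sum-cong-≗ (λ x → m+[n∸m]≡n (degree≤1 x)) ⟩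
    ∑[ x < n ] 1                                  ≡⟨ ∑-1 n ⟩
    n                                             ∎
    where
    open ≡-Reasoning
    ∑-1 : ∀ n → ∑[ x < n ] 1 ≡ n
    ∑-1 zero    = refl
    ∑-1 (suc n) = cong suc (∑-1 n)

unmatched⇔1≤1∸degree : ∀ {n} (M : Adjacency n) x → Unmatched M x ⇔ 1 ≤ 1 ∸ degree M x
unmatched⇔1≤1∸degree {n} M x = mk⇔ (λ unmatched → ≤-reflexive (cong (1 ∸_) (sym (degree≡0 unmatched)))) unmatched
  where
  degree≡0 : Unmatched M x → degree M x ≡ 0
  degree≡0 unmatched = trans (sum-cong-≗ (λ y → cong indicator (unmatched y))) (sum-replicate-zero n)
  edge⇒1≤degree : ∀ {y} → M x y ≡ true → 1 ≤ degree M x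
  edge⇒1≤degree {y} e = subst (λ b → indicator b ≤ degree M x) e (≤-∑ (λ y → indicator (M x y)) y)
  unmatched : 1 ≤ 1 ∸ degree M x → Unmatched M x
  unmatched 1≤1∸d y with M x y in e
  ... | false = refl
  ... | true  with () ← subst (1 ≤_) (m≤n⇒m∸n≡0 (edge⇒1≤degree e)) 1≤1∸d

unmatchedCount≤1⇔AtMostOneUnmatched : ∀ {n} (M : Adjacency n) → unmatchedCount M ≤ 1 ⇔ AtMostOneUnmatched M
unmatchedCount≤1⇔AtMostOneUnmatched M = mk⇔
  (λ c≤1 x y ux uy → ∑≤1⇒AtMostOne _ c≤1 x y (to (unmatched⇔1≤1∸degree M x) ux) (to (unmatched⇔1≤1∸degree M y) uy))
  (λ amo → AtMostOne⇒∑≤1 _ (λ x → m∸n≤m 1 (degree M x))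
     λ x y px py → amo x y (from (unmatched⇔1≤1∸degree M x) px) (from (unmatched⇔1≤1∸degree M y) py))

private
  odd-order-arithmetic : ∀ {s z k} → 2 * s + z ≡ suc (2 * k) → k ≤ s ⇔ z ≤ 1
  odd-order-arithmetic {s} {z} {k} e = mk⇔
    (λ k≤s → +-cancelˡ-≤ (2 * k) z 1 (begin
      2 * k + z   ≤⟨ +-monoˡ-≤ z (*-monoʳ-≤ 2 k≤s) ⟩
      2 * s + z   ≡⟨ e ⟩
      suc (2 * k) ≡⟨ +-comm 1 (2 * k) ⟩
      2 * k + 1   ∎))
    (λ z≤1 → *-cancelˡ-≤ 2 (+-cancelʳ-≤ 1 (2 * k) (2 * s) (begin
      2 * k + 1   ≡⟨ +-comm (2 * k) 1 ⟩
      suc (2 * k) ≡⟨ sym e ⟩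
      2 * s + z   ≤⟨ +-monoʳ-≤ (2 * s) z≤1 ⟩
      2 * s + 1   ∎)))
    where open Data.Nat.Properties.≤-Reasoning

  even-order-arithmetic : ∀ {s z k} → 2 * s + z ≡ 2 * k → z ≤ 1 → z ≡ 0
  even-order-arithmetic {s} {zero}        e _ = refl
  even-order-arithmetic {s} {suc zero} {k} e _ = ⊥-elim (even≢odd k s (sym (trans (+-comm 1 (2 * s)) e)))
  even-order-arithmetic {s} {suc (suc z)} e (s≤s ())

module _ {n} {H M : Adjacency n} (H-loopless : Loopless H) (isMatching : IsMatching H M) where
  private
    count : 2 * size M + unmatchedCount M ≡ n
    count = 2*size+unmatchedCount≡n isMatching H-loopless

  odd-order-size⇔ : ∀ {k} → n ≡ suc (2 * k) → k ≤ size M ⇔ AtMostOneUnmatched M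
  odd-order-size⇔ n≡ = mk⇔
    (to (unmatchedCount≤1⇔AtMostOneUnmatched M) ∘ to (odd-order-arithmetic (trans count n≡)))
    (from (odd-order-arithmetic (trans count n≡)) ∘ from (unmatchedCount≤1⇔AtMostOneUnmatched M))

  even-order-perfect : ∀ {k} → n ≡ 2 * k → AtMostOneUnmatched M → IsPerfect M
  even-order-perfect {k} n≡ amo x with matched-or-unmatched M x
  ... | inj₁ matched  = matched
  ... | inj₂ unmatched =
    contradiction (subst (1 ≤_) noneUnmatched (≤-trans (to (unmatched⇔1≤1∸degree M x) unmatched) (≤-∑ _ x))) λ ()
    where
    noneUnmatched : unmatchedCount M ≡ 0
    noneUnmatched = even-order-arithmetic {size M} {k = k} (trans count n≡) (from (unmatchedCount≤1⇔AtMostOneUnmatched M) amo)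

module _ {k} {H : Adjacency (suc (2 * k))} (H-loopless : Loopless H) {v} (unique : UniquelyUnmatched H v) where

  private
    delete-≐-perfect : ∀ {A} → IsMatching H A → Unmatched A v → AtMostOneUnmatched (delete A v) → delete A v ≐ proj₁ unique
    delete-≐-perfect isMatching unmatched amo = proj₂ (proj₂ unique) _
      (delete-isMatching isMatching unmatched ,
       even-order-perfect (H-loopless ∘ punchIn v) (delete-isMatching isMatching unmatched) {k} refl amo)

  uniquelyUnmatched-≐ : ∀ {A A'} → IsMatching H A → IsMatching H A' → Unmatched A v → Unmatched A' v →
    AtMostOneUnmatched (delete A v) → AtMostOneUnmatched (delete A' v) → A ≐ A'
  uniquelyUnmatched-≐ isMatching isMatching' unmatched unmatched' amo amo' =
    AgreeOff-unmatched⇒≐ (IsMatching.symmetric isMatching) (IsMatching.symmetric isMatching') unmatched unmatched'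
      (delete-≐⇒AgreeOff
        (≐-trans (delete-≐-perfect isMatching unmatched amo) (≐-sym (delete-≐-perfect isMatching' unmatched' amo'))))

module _ {G H : SGraph} (f : SGraph.V G → SGraph.V H) where
  private
    module G = SGraph G
    module H = SGraph H
    module ≈H = IsEquivalence H.isEquiv

  embedding⇒≅ : (∀ {x y} → x G.≈ y ⇔ f x H.≈ f y) → (∀ {x y} → G.E x y ⇔ H.E (f x) (f y)) →
    (∀ {x x' y y'} → x H.≈ x' → y H.≈ y' → H.E x y → H.E x' y') →
    (∀ y → Σ G.V λ x → f x H.≈ y) → H ≅ G
  embedding⇒≅ ≈⇔ E⇔ E-resp surjective = record
    { to        = preimage
    ; from      = f
    ; to-cong   = λ y≈y' → from ≈⇔ (≈H.trans (section _) (≈H.trans y≈y' (≈H.sym (section _))))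
    ; from-cong = to ≈⇔
    ; from-to   = section
    ; to-from   = λ x → from ≈⇔ (section (f x))
    ; E-to      = λ y y' e → from E⇔ (E-resp (≈H.sym (section y)) (≈H.sym (section y')) e)
    ; E-from    = λ y y' e → E-resp (section y) (section y') (to E⇔ e)
    }
    where
    preimage : H.V → G.V
    preimage y = proj₁ (surjective y)
    section : ∀ y → f (preimage y) H.≈ y
    section y = proj₂ (surjective y)

-- Wedges

Image : ∀ {p r} → (Fin p → Fin r) → Adjacency p → Fin r → Fin r → Set
Image f A w w' = ∃₂ λ x x' → w ≡ f x × w' ≡ f x' × A x x' ≡ true

Image-map : ∀ {p r} {f : Fin p → Fin r} {A A' w w'} →
  (∀ x x' → w ≡ f x → w' ≡ f x' → A x x' ≡ true → A' x x' ≡ true) → Image f A w w' → Image f A' w w'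
Image-map A⇒A' (x , x' , w≡ , w'≡ , e) = x , x' , w≡ , w'≡ , A⇒A' x x' w≡ w'≡ e

Image-≐ : ∀ {p r} {f : Fin p → Fin r} {A A' w w'} → A ≐ A' → Image f A w w' → Image f A' w w'
Image-≐ A≐A' = Image-map λ x x' _ _ e → trans (sym (A≐A' x x')) e

Image-agree : ∀ {p r} {f : Fin p → Fin r} {A A' x w w'} → AgreeOff A A' x → w ≢ f x → w' ≢ f x →
  Image f A w w' → Image f A' w w'
Image-agree {f = f} agree w≢ w'≢ = Image-map λ a a' w≡ w'≡ e →
  trans (sym (agree a a' (λ a≡x → w≢ (trans w≡ (cong f a≡x))) (λ a'≡x → w'≢ (trans w'≡ (cong f a'≡x))))) e

Image-transpose : ∀ {p r} {f : Fin p → Fin r} {A w w'} → (∀ x y → A x y ≡ A y x) → Image f A w w' → Image f A w' w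
Image-transpose symmetric (x , x' , w≡ , w'≡ , e) = x' , x , w'≡ , w≡ , trans (symmetric x' x) e

Image-restrict : ∀ {p r} {f : Fin p → Fin r} {H M w w'} → Image f H w w' → M w w' ≡ true → Image f (restrict f M) w w'
Image-restrict (x , x' , refl , refl , _) e = x , x' , refl , refl , e

Image-restrict⁻ : ∀ {p r} {f : Fin p → Fin r} {M w w'} → Image f (restrict f M) w w' → M w w' ≡ true
Image-restrict⁻ (x , x' , refl , refl , e) = e

-- The vertex set of (H₁ ⊔ H₂)/(v₁ ∼ v₂): two copies of the vertex sets meeting exactly in
-- ι₁ v₁ = ι₂ v₂. The interface is symmetric, so `swap` transfers every one-sided lemma.
record Wedging {p q r : ℕ} (v₁ : Fin p) (v₂ : Fin q) : Set where
  field
    ι₁           : Fin p → Fin r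
    ι₂           : Fin q → Fin r
    ι₁-injective : Injective _≡_ _≡_ ι₁
    ι₂-injective : Injective _≡_ _≡_ ι₂
    ι₁≡ι₂⇔       : ∀ {x z} → ι₁ x ≡ ι₂ z ⇔ (x ≡ v₁ × z ≡ v₂)
    ι₁-or-ι₂     : ∀ w → (∃ λ x → w ≡ ι₁ x) ⊎ (∃ λ z → w ≡ ι₂ z)
    _⊕_          : Adjacency p → Adjacency q → Adjacency r
    ⊕-edge⇔      : ∀ {A B w w'} → (A ⊕ B) w w' ≡ true ⇔ (Image ι₁ A w w' ⊎ Image ι₂ B w w')

  swap : Wedging v₂ v₁
  swap = record
    { ι₁           = ι₂
    ; ι₂           = ι₁
    ; ι₁-injective = ι₂-injective
    ; ι₂-injective = ι₁-injective
    ; ι₁≡ι₂⇔       = mk⇔ (λ e → Data.Product.swap (to ι₁≡ι₂⇔ (sym e)))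
                         (λ (z≡v₂ , x≡v₁) → sym (from ι₁≡ι₂⇔ (x≡v₁ , z≡v₂)))
    ; ι₁-or-ι₂     = Data.Sum.swap ∘ ι₁-or-ι₂
    ; _⊕_          = flip _⊕_
    ; ⊕-edge⇔      = mk⇔ (Data.Sum.swap ∘ to ⊕-edge⇔) (from ⊕-edge⇔ ∘ Data.Sum.swap)
    }

module WedgingSide {p q r} {v₁ : Fin p} {v₂ : Fin q} (𝒲 : Wedging {p} {q} {r} v₁ v₂) where
  open Wedging 𝒲

  glue-point : ι₁ v₁ ≡ ι₂ v₂
  glue-point = from ι₁≡ι₂⇔ (refl , refl)

  ⊕-≡ : ∀ {A A' B B' w w'} →
    (Image ι₁ A w w' ⊎ Image ι₂ B w w' → Image ι₁ A' w w' ⊎ Image ι₂ B' w w') →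
    (Image ι₁ A' w w' ⊎ Image ι₂ B' w w' → Image ι₁ A w w' ⊎ Image ι₂ B w w') →
    (A ⊕ B) w w' ≡ (A' ⊕ B') w w'
  ⊕-≡ there back = ⇔→≡ (mk⇔ (from ⊕-edge⇔ ∘ there ∘ to ⊕-edge⇔) (from ⊕-edge⇔ ∘ back ∘ to ⊕-edge⇔))

  ⊕-cong : ∀ {A A' B B'} → A ≐ A' → B ≐ B' → (A ⊕ B) ≐ (A' ⊕ B')
  ⊕-cong A≐A' B≐B' w w' = ⊕-≡
    (Data.Sum.map (Image-≐ A≐A') (Image-≐ B≐B'))
    (Data.Sum.map (Image-≐ (≐-sym A≐A')) (Image-≐ (≐-sym B≐B')))

  ⊕-restrict : ∀ {A B} → B v₂ v₂ ≡ false → restrict ι₁ (A ⊕ B) ≐ A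
  ⊕-restrict {A} {B} B-loopless x x' = ⇔→≡ (mk⇔ there λ e → from ⊕-edge⇔ (inj₁ (x , x' , refl , refl , e)))
    where
    there : (A ⊕ B) (ι₁ x) (ι₁ x') ≡ true → A x x' ≡ true
    there e with to ⊕-edge⇔ e
    ... | inj₁ (_ , _ , ι₁x≡ , ι₁x'≡ , e') with refl ← ι₁-injective ι₁x≡ | refl ← ι₁-injective ι₁x'≡ = e'
    ... | inj₂ (_ , _ , ι₁x≡ , ι₁x'≡ , e') with (_ , refl) ← to ι₁≡ι₂⇔ ι₁x≡ | (_ , refl) ← to ι₁≡ι₂⇔ ι₁x'≡ =
      ⊥-elim (true≢false (trans (sym e') B-loopless))

  ⊕-injectiveˡ : ∀ {A A' B B'} → B v₂ v₂ ≡ false → B' v₂ v₂ ≡ false → (A ⊕ B) ≐ (A' ⊕ B') → A ≐ A'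
  ⊕-injectiveˡ B-loopless B'-loopless ⊕≐ x x' =
    trans (sym (⊕-restrict B-loopless x x')) (trans (⊕≐ _ _) (⊕-restrict B'-loopless x x'))

  restrict-isMatching-ι₁ : ∀ {H₁ H₂ M} → H₂ v₂ v₂ ≡ false → IsMatching (H₁ ⊕ H₂) M → IsMatching H₁ (restrict ι₁ M)
  restrict-isMatching-ι₁ H₂-loopless = restrict-isMatching ι₁-injective (⊕-restrict H₂-loopless)

  unmatched-ι₁ : ∀ {H₁ H₂ M x} → IsMatching (H₁ ⊕ H₂) M → Unmatched (restrict ι₁ M) x →
    (x ≡ v₁ → Unmatched (restrict ι₂ M) v₂) → Unmatched M (ι₁ x)
  unmatched-ι₁ {M = M} {x} isMatching x-unmatched glue-point-unmatched w with M (ι₁ x) w in e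
  ... | false = refl
  ... | true with to ⊕-edge⇔ (IsMatching.sub isMatching _ _ e)
  ...   | inj₁ (_ , x' , ι₁x≡ , refl , _) with refl ← ι₁-injective ι₁x≡ = ⊥-elim (true≢false (trans (sym e) (x-unmatched x')))
  ...   | inj₂ (_ , z , ι₁x≡ , refl , _) with (refl , refl) ← to ι₁≡ι₂⇔ ι₁x≡ =
    ⊥-elim (true≢false (trans (sym e) (trans (cong (λ u → M u (ι₂ z)) glue-point) (glue-point-unmatched refl z))))

  AgreeOff-at-ι₁ : ∀ {M N x} → AgreeOff M N (ι₁ x) →
    AgreeOff (restrict ι₁ M) (restrict ι₁ N) x × AgreeOff (restrict ι₂ M) (restrict ι₂ N) v₂
  AgreeOff-at-ι₁ agree =
    AgreeOff-restrict (λ _ → ι₁-injective) agree ,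
    AgreeOff-restrict (λ _ e → proj₂ (to ι₁≡ι₂⇔ (sym e))) agree

  AgreeOff-⊕ : ∀ {A A' B B' x} → AgreeOff A A' x → B ≐ B' → AgreeOff (A ⊕ B) (A' ⊕ B') (ι₁ x)
  AgreeOff-⊕ agree B≐B' w w' w≢ w'≢ = ⊕-≡
    (Data.Sum.map (Image-agree agree w≢ w'≢) (Image-≐ B≐B'))
    (Data.Sum.map (Image-agree (AgreeOff-sym agree) w≢ w'≢) (Image-≐ (≐-sym B≐B')))

module WedgingProperties {p q r} {v₁ : Fin p} {v₂ : Fin q} (𝒲 : Wedging {p} {q} {r} v₁ v₂) where
  open Wedging 𝒲
  open WedgingSide 𝒲 public
  module Swapped = WedgingSide swap

  ⊕-≐⇔ : ∀ {A A' B B'} → A v₁ v₁ ≡ false → A' v₁ v₁ ≡ false → B v₂ v₂ ≡ false → B' v₂ v₂ ≡ false →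
    (A ⊕ B) ≐ (A' ⊕ B') ⇔ (A ≐ A' × B ≐ B')
  ⊕-≐⇔ A-loopless A'-loopless B-loopless B'-loopless = mk⇔
    (λ ⊕≐ → ⊕-injectiveˡ B-loopless B'-loopless ⊕≐ , Swapped.⊕-injectiveˡ A-loopless A'-loopless ⊕≐)
    λ (A≐A' , B≐B') → ⊕-cong A≐A' B≐B'

  restrict-⊕-≐ : ∀ {H₁ H₂ M} → IsMatching (H₁ ⊕ H₂) M → M ≐ (restrict ι₁ M ⊕ restrict ι₂ M)
  restrict-⊕-≐ {M = M} isMatching w w' = ⇔→≡ (mk⇔
    (λ e → from ⊕-edge⇔ (Data.Sum.map (λ i → Image-restrict i e) (λ i → Image-restrict i e)
                           (to ⊕-edge⇔ (IsMatching.sub isMatching w w' e))))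
    (λ e → Data.Sum.[ Image-restrict⁻ {M = M} , Image-restrict⁻ {M = M} ] (to ⊕-edge⇔ e)))

  ⊕-isMatching : ∀ {H₁ H₂ A B} → IsMatching H₁ A → IsMatching H₂ B → Unmatched A v₁ ⊎ Unmatched B v₂ →
    IsMatching (H₁ ⊕ H₂) (A ⊕ B)
  ⊕-isMatching {A = A} {B} A-matching B-matching one-unmatched = record
    { sub       = λ w w' e → from ⊕-edge⇔ (Data.Sum.map (Image-map λ x x' _ _ → A.sub x x') (Image-map λ z z' _ _ → B.sub z z')
                                                      (to ⊕-edge⇔ e))
    ; symmetric = λ w w' → ⇔→≡ (mk⇔ transpose transpose)
    ; disjoint  = λ w w₁ w₂ e₁ e₂ → disjoint (to ⊕-edge⇔ e₁) (to ⊕-edge⇔ e₂)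
    }
    where
    module A = IsMatching A-matching
    module B = IsMatching B-matching
    transpose : ∀ {w w'} → (A ⊕ B) w w' ≡ true → (A ⊕ B) w' w ≡ true
    transpose = from ⊕-edge⇔ ∘ Data.Sum.map (Image-transpose A.symmetric) (Image-transpose B.symmetric) ∘ to ⊕-edge⇔
    not-both : ∀ {x z} → A v₁ x ≡ true → B v₂ z ≡ true → ⊥
    not-both {x} {z} eA eB = Data.Sum.[ (λ A-unmatched → true≢false (trans (sym eA) (A-unmatched x))) ,
                                        (λ B-unmatched → true≢false (trans (sym eB) (B-unmatched z))) ] one-unmatched
    disjoint : ∀ {w w₁ w₂} → Image ι₁ A w w₁ ⊎ Image ι₂ B w w₁ → Image ι₁ A w w₂ ⊎ Image ι₂ B w w₂ → w₁ ≡ w₂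
    disjoint (inj₁ (x , x₁ , refl , refl , e₁)) (inj₁ (_ , x₂ , ι₁x≡ , refl , e₂)) with refl ← ι₁-injective ι₁x≡ =
      cong ι₁ (A.disjoint x x₁ x₂ e₁ e₂)
    disjoint (inj₂ (z , z₁ , refl , refl , e₁)) (inj₂ (_ , z₂ , ι₂z≡ , refl , e₂)) with refl ← ι₂-injective ι₂z≡ =
      cong ι₂ (B.disjoint z z₁ z₂ e₁ e₂)
    disjoint (inj₁ (x , _ , refl , refl , e₁)) (inj₂ (_ , _ , ι₁x≡ , refl , e₂)) with (refl , refl) ← to ι₁≡ι₂⇔ ι₁x≡ =
      ⊥-elim (not-both e₁ e₂)
    disjoint (inj₂ (z , _ , refl , refl , e₁)) (inj₁ (_ , _ , ι₂z≡ , refl , e₂)) with (refl , refl) ← to ι₁≡ι₂⇔ (sym ι₂z≡) =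
      ⊥-elim (not-both e₂ e₁)

  glue-point-unmatched : ∀ {H₁ H₂ M} → IsMatching (H₁ ⊕ H₂) M → Loopless M →
    Unmatched (restrict ι₁ M) v₁ ⊎ Unmatched (restrict ι₂ M) v₂
  glue-point-unmatched {M = M} isMatching M-loopless with matched-or-unmatched (restrict ι₁ M) v₁
  ... | inj₂ unmatched₁ = inj₁ unmatched₁
  ... | inj₁ (x , e) = inj₂ unmatched₂
    where
    unmatched₂ : Unmatched (restrict ι₂ M) v₂
    unmatched₂ z with M (ι₂ v₂) (ι₂ z) in e'
    ... | false = refl
    ... | true with (refl , _) ← to ι₁≡ι₂⇔ (IsMatching.disjoint isMatching _ _ _ e (subst (λ u → M u (ι₂ z) ≡ true) (sym glue-point) e')) =
      ⊥-elim (true≢false (trans (sym e) (M-loopless (ι₁ v₁))))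

  AgreeOff-split : ∀ {M N w} → AgreeOff M N w → ∃₂ λ x z → (x ≡ v₁ ⊎ z ≡ v₂) ×
    AgreeOff (restrict ι₁ M) (restrict ι₁ N) x × AgreeOff (restrict ι₂ M) (restrict ι₂ N) z
  AgreeOff-split {w = w} agree with ι₁-or-ι₂ w
  ... | inj₁ (x , refl) = let (agree₁ , agree₂) = AgreeOff-at-ι₁ agree in x , v₂ , inj₂ refl , agree₁ , agree₂
  ... | inj₂ (z , refl) = let (agree₂ , agree₁) = Swapped.AgreeOff-at-ι₁ agree in v₁ , z , inj₁ refl , agree₁ , agree₂

  ⊕-loopless : ∀ {A B} → Loopless A → Loopless B → Loopless (A ⊕ B)
  ⊕-loopless {A} {B} A-loopless B-loopless w with (A ⊕ B) w w in e
  ... | false = refl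
  ... | true with to ⊕-edge⇔ e
  ...   | inj₁ (x , _ , refl , ι₁x≡ , e') with refl ← ι₁-injective ι₁x≡ = ⊥-elim (true≢false (trans (sym e') (A-loopless x)))
  ...   | inj₂ (z , _ , refl , ι₂z≡ , e') with refl ← ι₂-injective ι₂z≡ = ⊥-elim (true≢false (trans (sym e') (B-loopless z)))

  Adjacent-⊕ : ∀ {A A' B} → B v₂ v₂ ≡ false → Adjacent A A' → Adjacent (A ⊕ B) (A' ⊕ B)
  Adjacent-⊕ B-loopless (A≢A' , x , agree) =
    (A≢A' ∘ ⊕-injectiveˡ B-loopless B-loopless) ,
    ι₁ x , AgreeOff-⊕ agree ≐-refl

  Adjacent-⊕⁻ : ∀ {A A' B} → B v₂ v₂ ≡ false → Adjacent (A ⊕ B) (A' ⊕ B) → Adjacent A A'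
  Adjacent-⊕⁻ B-loopless (⊕≢ , w , agree) with AgreeOff-split agree
  ... | x , _ , _ , agree₁ , _ =
    (λ A≐A' → ⊕≢ (⊕-cong A≐A' ≐-refl)) ,
    x , AgreeOff-resp (⊕-restrict B-loopless) (⊕-restrict B-loopless) agree₁

module _ {m n : ℕ} (v₁ : Fin m) (v₂ : Fin (suc n)) where
  private
    data ↑-View : Fin (m + n) → Set where
      left  : ∀ x → ↑-View (x ↑ˡ n)
      right : ∀ y → ↑-View (m ↑ʳ y)

    ↑-view : ∀ w → ↑-View w
    ↑-view w with splitAt m w in eq
    ... | inj₁ x = subst ↑-View (splitAt⁻¹-↑ˡ eq) (left x)
    ... | inj₂ y = subst ↑-View (splitAt⁻¹-↑ʳ eq) (right y)

    ι₁ : Fin m → Fin (m + n)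
    ι₁ x = x ↑ˡ n

    ι₂ : Fin (suc n) → Fin (m + n)
    ι₂ z with z ≟ v₂
    ... | yes _   = ι₁ v₁
    ... | no z≢v₂ = m ↑ʳ punchOut (z≢v₂ ∘ sym)

    ι₂-v₂ : ι₂ v₂ ≡ ι₁ v₁
    ι₂-v₂ with v₂ ≟ v₂
    ... | yes _ = refl
    ... | no v₂≢v₂ = ⊥-elim (v₂≢v₂ refl)

    ι₂-punchIn : ∀ y → ι₂ (punchIn v₂ y) ≡ m ↑ʳ y
    ι₂-punchIn y with punchIn v₂ y ≟ v₂
    ... | yes p≡v₂ = ⊥-elim (punchInᵢ≢i v₂ y p≡v₂)
    ... | no p≢v₂  = cong (m ↑ʳ_) (trans (punchOut-cong v₂ refl) (punchOut-punchIn v₂))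

    ↑ˡ≢↑ʳ : ∀ x y → x ↑ˡ n ≢ m ↑ʳ y
    ↑ˡ≢↑ʳ x y e with () ← trans (sym (splitAt-↑ˡ m x n)) (trans (cong (splitAt m) e) (splitAt-↑ʳ m n y))

    -- The omitted cases have the hypothesis false ≡ true.
    glue-edge⁺ : ∀ {A B w w'} → glue A v₁ B v₂ w w' ≡ true → Image ι₁ A w w' ⊎ Image ι₂ B w w'
    glue-edge⁺ {A} {B} {w} {w'} e with ↑-view w | ↑-view w'
    ... | left x | left x' with splitAt m (x ↑ˡ n) | splitAt-↑ˡ m x n | splitAt m (x' ↑ˡ n) | splitAt-↑ˡ m x' n
    ...   | _ | refl | _ | refl with A x x' in eA | x ≟ v₁ | x' ≟ v₁
    ...     | true  | _        | _        = inj₁ (x , x' , refl , refl , eA)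
    ...     | false | yes refl | yes refl = inj₂ (v₂ , v₂ , sym ι₂-v₂ , sym ι₂-v₂ , e)
    glue-edge⁺ e | left x | right y with splitAt m (x ↑ˡ n) | splitAt-↑ˡ m x n | splitAt m (m ↑ʳ y) | splitAt-↑ʳ m n y
    ...   | _ | refl | _ | refl with x ≟ v₁
    ...     | yes refl = inj₂ (v₂ , punchIn v₂ y , sym ι₂-v₂ , sym (ι₂-punchIn y) , e)
    glue-edge⁺ e | right y | left x with splitAt m (x ↑ˡ n) | splitAt-↑ˡ m x n | splitAt m (m ↑ʳ y) | splitAt-↑ʳ m n y
    ...   | _ | refl | _ | refl with x ≟ v₁
    ...     | yes refl = inj₂ (punchIn v₂ y , v₂ , sym (ι₂-punchIn y) , sym ι₂-v₂ , e)
    glue-edge⁺ e | right y | right y' with splitAt m (m ↑ʳ y) | splitAt-↑ʳ m n y | splitAt m (m ↑ʳ y') | splitAt-↑ʳ m n y'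
    ...   | _ | refl | _ | refl = inj₂ (punchIn v₂ y , punchIn v₂ y' , sym (ι₂-punchIn y) , sym (ι₂-punchIn y') , e)

    glue-edge⁻ : ∀ {A B w w'} → Image ι₁ A w w' ⊎ Image ι₂ B w w' → glue A v₁ B v₂ w w' ≡ true
    glue-edge⁻ (inj₁ (x , x' , refl , refl , e))
      with splitAt m (x ↑ˡ n) | splitAt-↑ˡ m x n | splitAt m (x' ↑ˡ n) | splitAt-↑ˡ m x' n
    ... | _ | refl | _ | refl rewrite e = refl
    glue-edge⁻ {A} {B} (inj₂ (z , z' , refl , refl , e)) with punchIn-view v₂ z | punchIn-view v₂ z'
    ... | inj₁ refl | inj₁ refl rewrite ι₂-v₂
      with splitAt m (v₁ ↑ˡ n) | splitAt-↑ˡ m v₁ n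
    ...   | _ | refl rewrite dec-true (v₁ ≟ v₁) refl | e = ∨-zeroʳ (A v₁ v₁)
    glue-edge⁻ (inj₂ (z , z' , refl , refl , e)) | inj₁ refl | inj₂ (y' , refl) rewrite ι₂-v₂ | ι₂-punchIn y'
      with splitAt m (v₁ ↑ˡ n) | splitAt-↑ˡ m v₁ n | splitAt m (m ↑ʳ y') | splitAt-↑ʳ m n y'
    ...   | _ | refl | _ | refl rewrite dec-true (v₁ ≟ v₁) refl = e
    glue-edge⁻ (inj₂ (z , z' , refl , refl , e)) | inj₂ (y , refl) | inj₁ refl rewrite ι₂-v₂ | ι₂-punchIn y
      with splitAt m (v₁ ↑ˡ n) | splitAt-↑ˡ m v₁ n | splitAt m (m ↑ʳ y) | splitAt-↑ʳ m n y
    ...   | _ | refl | _ | refl rewrite dec-true (v₁ ≟ v₁) refl = e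
    glue-edge⁻ (inj₂ (z , z' , refl , refl , e)) | inj₂ (y , refl) | inj₂ (y' , refl) rewrite ι₂-punchIn y | ι₂-punchIn y'
      with splitAt m (m ↑ʳ y) | splitAt-↑ʳ m n y | splitAt m (m ↑ʳ y') | splitAt-↑ʳ m n y'
    ...   | _ | refl | _ | refl = e

    ι₂-injective : Injective _≡_ _≡_ ι₂
    ι₂-injective {z} {z'} e with punchIn-view v₂ z | punchIn-view v₂ z'
    ... | inj₁ refl       | inj₁ refl        = refl
    ... | inj₁ refl       | inj₂ (y' , refl) = ⊥-elim (↑ˡ≢↑ʳ v₁ y' (trans (sym ι₂-v₂) (trans e (ι₂-punchIn y'))))
    ... | inj₂ (y , refl) | inj₁ refl        = ⊥-elim (↑ˡ≢↑ʳ v₁ y (trans (sym ι₂-v₂) (trans (sym e) (ι₂-punchIn y))))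
    ... | inj₂ (y , refl) | inj₂ (y' , refl) =
      cong (punchIn v₂) (↑ʳ-injective m y y' (trans (sym (ι₂-punchIn y)) (trans e (ι₂-punchIn y'))))

    ι₁≡ι₂⇒ : ∀ {x z} → ι₁ x ≡ ι₂ z → x ≡ v₁ × z ≡ v₂
    ι₁≡ι₂⇒ {x} {z} e with punchIn-view v₂ z
    ... | inj₁ refl       = ↑ˡ-injective n x v₁ (trans e ι₂-v₂) , refl
    ... | inj₂ (y , refl) = ⊥-elim (↑ˡ≢↑ʳ x y (trans e (ι₂-punchIn y)))

    ι₁-or-ι₂ : ∀ w → (∃ λ x → w ≡ ι₁ x) ⊎ (∃ λ z → w ≡ ι₂ z)
    ι₁-or-ι₂ w with ↑-view w
    ... | left x  = inj₁ (x , refl)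
    ... | right y = inj₂ (punchIn v₂ y , sym (ι₂-punchIn y))

  glueWedging : Wedging v₁ v₂
  glueWedging = record
    { ι₁           = ι₁
    ; ι₂           = ι₂
    ; ι₁-injective = ↑ˡ-injective n _ _
    ; ι₂-injective = ι₂-injective
    ; ι₁≡ι₂⇔       = mk⇔ ι₁≡ι₂⇒ λ { (refl , refl) → sym ι₂-v₂ }
    ; ι₁-or-ι₂     = ι₁-or-ι₂
    ; _⊕_          = λ A B → glue A v₁ B v₂
    ; ⊕-edge⇔      = mk⇔ glue-edge⁺ glue-edge⁻
    }

-- Wedges of graphs with a uniquely unmatched vertex

record UniquelyUnmatchedVertex (k : ℕ) : Set where
  field
    H            : Adjacency (suc (2 * k))
    simple       : IsSimple H
    v            : Fin (suc (2 * k))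
    unique       : UniquelyUnmatched H v
    Mv           : MVertex H k
    Mv-unmatched : Unmatched (proj₁ Mv) v

  Mᵥ : Adjacency (suc (2 * k))
  Mᵥ = proj₁ Mv

  loopless : Loopless H
  loopless = IsSimple.irreflexive simple

  size⇔ : ∀ {A} → IsMatching H A → k ≤ size A ⇔ AtMostOneUnmatched A
  size⇔ A-matching = odd-order-size⇔ loopless A-matching refl

  Mᵥ-matching : IsMatching H Mᵥ
  Mᵥ-matching = proj₁ (proj₂ Mv)

  Mᵥ-amo : AtMostOneUnmatched Mᵥ
  Mᵥ-amo = to (size⇔ Mᵥ-matching) (proj₂ (proj₂ Mv))

  Mᵥ-loopless : Mᵥ v v ≡ false
  Mᵥ-loopless = Mv-unmatched v

  ≐-Mᵥ : ∀ {A} → IsMatching H A → Unmatched A v → AtMostOneUnmatched (delete A v) → A ≐ Mᵥ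
  ≐-Mᵥ A-matching A-unmatched amo = uniquelyUnmatched-≐ {k = k} loopless unique A-matching Mᵥ-matching A-unmatched Mv-unmatched
    amo (AtMostOneUnmatched-delete Mᵥ-matching Mv-unmatched Mᵥ-amo)

  AgreeOff-Mᵥ⇒≐ : ∀ {A} → IsMatching H A → AgreeOff Mᵥ A v → A ≐ Mᵥ
  AgreeOff-Mᵥ⇒≐ A-matching = AgreeOff⇒≐ loopless Mᵥ-matching A-matching Mᵥ-amo Mv-unmatched

module Decomposition {k₁ k₂ r} (S₁ : UniquelyUnmatchedVertex k₁) (S₂ : UniquelyUnmatchedVertex k₂)
    (𝒲 : Wedging {r = r} (UniquelyUnmatchedVertex.v S₁) (UniquelyUnmatchedVertex.v S₂)) where
  open Wedging 𝒲
  open WedgingProperties 𝒲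
  private
    module S₁ = UniquelyUnmatchedVertex S₁
    module S₂ = UniquelyUnmatchedVertex S₂

  module _ {M} (M-matching : IsMatching (S₁.H ⊕ S₂.H) M) (amo : AtMostOneUnmatched M)
           (unmatched₁ : Unmatched (restrict ι₁ M) S₁.v) where

    -- M may match v₁ into H₂, so only H₁ - v₁ is known to have at most one unmatched vertex.
    restrict-≐-Mᵥ : restrict ι₁ M ≐ S₁.Mᵥ
    restrict-≐-Mᵥ = S₁.≐-Mᵥ restricted-matching unmatched₁
      (AtMostOneUnmatched-restrict (punchIn-injective S₁.v _ _ ∘ ι₁-injective)
        (λ x ux → unmatched-ι₁ M-matching (unmatched-delete restricted-matching unmatched₁ ux) (⊥-elim ∘ punchInᵢ≢i S₁.v x))
        amo)
      where
      restricted-matching : IsMatching S₁.H (restrict ι₁ M)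
      restricted-matching = restrict-isMatching-ι₁ (S₂.loopless S₂.v) M-matching

    restrict₂-amo : AtMostOneUnmatched (restrict ι₂ M)
    restrict₂-amo = AtMostOneUnmatched-restrict ι₂-injective
      (λ z uz → Swapped.unmatched-ι₁ M-matching uz λ { refl → unmatched₁ }) amo

    ≐-Mᵥ-⊕ : M ≐ (S₁.Mᵥ ⊕ restrict ι₂ M)
    ≐-Mᵥ-⊕ = ≐-trans (restrict-⊕-≐ M-matching) (⊕-cong restrict-≐-Mᵥ ≐-refl)

  module _ {B} (B-matching : IsMatching S₂.H B) where

    Mᵥ-⊕-isMatching : IsMatching (S₁.H ⊕ S₂.H) (S₁.Mᵥ ⊕ B)
    Mᵥ-⊕-isMatching = ⊕-isMatching S₁.Mᵥ-matching B-matching (inj₁ S₁.Mv-unmatched)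

    Mᵥ-⊕-amo : AtMostOneUnmatched B → AtMostOneUnmatched (S₁.Mᵥ ⊕ B)
    Mᵥ-⊕-amo amo = AtMostOneUnmatched-extend in-ι₂
      (AtMostOneUnmatched-resp (≐-sym (Swapped.⊕-restrict S₁.Mᵥ-loopless)) amo)
      where
      in-ι₂ : ∀ w → Unmatched (S₁.Mᵥ ⊕ B) w → ∃ λ z → w ≡ ι₂ z
      in-ι₂ w uw with ι₁-or-ι₂ w
      ... | inj₂ in-image = in-image
      ... | inj₁ (x , refl) with refl ← S₁.Mᵥ-amo x S₁.v
                                   (λ x' → trans (sym (⊕-restrict (matching-loopless B-matching S₂.loopless S₂.v) x x')) (uw (ι₁ x')))
                                   S₁.Mv-unmatched = S₂.v , glue-point

module WedgeIsomorphism {k₁ k₂ r} (S₁ : UniquelyUnmatchedVertex k₁) (S₂ : UniquelyUnmatchedVertex k₂)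
    (𝒲 : Wedging {r = r} (UniquelyUnmatchedVertex.v S₁) (UniquelyUnmatchedVertex.v S₂))
    (order : r ≡ suc (2 * (k₁ + k₂))) where
  open Wedging 𝒲
  open WedgingProperties 𝒲
  private
    module S₁ = UniquelyUnmatchedVertex S₁
    module S₂ = UniquelyUnmatchedVertex S₂
    module D₁ = Decomposition S₁ S₂ 𝒲
    module D₂ = Decomposition S₂ S₁ swap
    module Side₂ = WedgingProperties swap

  Glued : SGraph
  Glued = MatchingGraph (k₁ + k₂) (S₁.H ⊕ S₂.H)

  Wedged : SGraph
  Wedged = Wedge (MatchingGraph k₁ S₁.H) (MatchingGraph k₂ S₂.H) S₁.Mv S₂.Mv

  open SGraph using (V; E)
  private
    module Wedged = SGraph Wedged
    module ≈W = IsEquivalence Wedged.isEquiv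

  glued-size⇔ : ∀ {M} → IsMatching (S₁.H ⊕ S₂.H) M → k₁ + k₂ ≤ size M ⇔ AtMostOneUnmatched M
  glued-size⇔ M-matching = odd-order-size⇔ (⊕-loopless S₁.loopless S₂.loopless) M-matching order

  sides : V Wedged → Adjacency (suc (2 * k₁)) × Adjacency (suc (2 * k₂))
  sides (inj₁ (A , _)) = A , S₂.Mᵥ
  sides (inj₂ (B , _)) = S₁.Mᵥ , B

  ⟦_⟧ : V Wedged → Adjacency r
  ⟦ p ⟧ = proj₁ (sides p) ⊕ proj₂ (sides p)

  sides-loopless : ∀ p → proj₁ (sides p) S₁.v S₁.v ≡ false × proj₂ (sides p) S₂.v S₂.v ≡ false
  sides-loopless (inj₁ (A , A-matching , _)) = matching-loopless A-matching S₁.loopless S₁.v , S₂.Mᵥ-loopless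
  sides-loopless (inj₂ (B , B-matching , _)) = S₁.Mᵥ-loopless , matching-loopless B-matching S₂.loopless S₂.v

  embed : V Wedged → V Glued
  embed p = ⟦ p ⟧ , isMatching p , from (glued-size⇔ (isMatching p)) (amo p)
    where
    isMatching : ∀ p → IsMatching (S₁.H ⊕ S₂.H) ⟦ p ⟧
    isMatching (inj₁ (A , A-matching , _)) = D₂.Mᵥ-⊕-isMatching A-matching
    isMatching (inj₂ (B , B-matching , _)) = D₁.Mᵥ-⊕-isMatching B-matching
    amo : ∀ p → AtMostOneUnmatched ⟦ p ⟧
    amo (inj₁ (A , A-matching , A-size)) = D₂.Mᵥ-⊕-amo A-matching (to (S₁.size⇔ A-matching) A-size)
    amo (inj₂ (B , B-matching , B-size)) = D₁.Mᵥ-⊕-amo B-matching (to (S₂.size⇔ B-matching) B-size)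

  sides-≈⇔ : ∀ {p q} → p Wedged.≈ q ⇔ (proj₁ (sides p) ≐ proj₁ (sides q) × proj₂ (sides p) ≐ proj₂ (sides q))
  sides-≈⇔ {inj₁ _} {inj₁ _} = mk⇔ (_, ≐-refl) proj₁
  sides-≈⇔ {inj₁ _} {inj₂ _} = mk⇔ (λ (A≐ , B≐) → A≐ , ≐-sym B≐) (λ (A≐ , B≐) → A≐ , ≐-sym B≐)
  sides-≈⇔ {inj₂ _} {inj₁ _} = mk⇔ (λ (B≐ , A≐) → ≐-sym A≐ , B≐) (λ (A≐ , B≐) → B≐ , ≐-sym A≐)
  sides-≈⇔ {inj₂ _} {inj₂ _} = mk⇔ (≐-refl ,_) proj₂

  embed-≈⇔ : ∀ p q → p Wedged.≈ q ⇔ ⟦ p ⟧ ≐ ⟦ q ⟧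
  embed-≈⇔ p q = mk⇔ (from ⊕≐⇔ ∘ to (sides-≈⇔ {p} {q})) (from (sides-≈⇔ {p} {q}) ∘ to ⊕≐⇔)
    where
    ⊕≐⇔ = ⊕-≐⇔ (proj₁ (sides-loopless p)) (proj₁ (sides-loopless q)) (proj₂ (sides-loopless p)) (proj₂ (sides-loopless q))

  private
    mixed-adjacency : ∀ {A B} → IsMatching S₁.H A → IsMatching S₂.H B → Adjacent (A ⊕ S₂.Mᵥ) (S₁.Mᵥ ⊕ B) →
      (A ≐ S₁.Mᵥ × Adjacent S₂.Mᵥ B) ⊎ (B ≐ S₂.Mᵥ × Adjacent A S₁.Mᵥ)
    mixed-adjacency {A} {B} A-matching B-matching (⊕≢ , w , agree) with AgreeOff-split agree
    ... | x , z , at-glue-point , agree₁ , agree₂ = decide at-glue-point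
      (AgreeOff-resp (⊕-restrict S₂.Mᵥ-loopless) (⊕-restrict (matching-loopless B-matching S₂.loopless S₂.v)) agree₁)
      (AgreeOff-resp (Swapped.⊕-restrict (matching-loopless A-matching S₁.loopless S₁.v)) (Swapped.⊕-restrict S₁.Mᵥ-loopless) agree₂)
      where
      decide : x ≡ S₁.v ⊎ z ≡ S₂.v → AgreeOff A S₁.Mᵥ x → AgreeOff S₂.Mᵥ B z →
        (A ≐ S₁.Mᵥ × Adjacent S₂.Mᵥ B) ⊎ (B ≐ S₂.Mᵥ × Adjacent A S₁.Mᵥ)
      decide (inj₁ refl) agree-A agree-B = inj₁ (A≐ , (λ A₂≐B → ⊕≢ (⊕-cong A≐ A₂≐B)) , z , agree-B)
        where A≐ = S₁.AgreeOff-Mᵥ⇒≐ A-matching (AgreeOff-sym agree-A)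
      decide (inj₂ refl) agree-A agree-B = inj₂ (B≐ , (λ A≐A₁ → ⊕≢ (⊕-cong A≐A₁ (≐-sym B≐))) , x , agree-A)
        where B≐ = S₂.AgreeOff-Mᵥ⇒≐ B-matching agree-B

  private
    Adjacent-resp-≈ : ∀ p q u w → p Wedged.≈ u → q Wedged.≈ w → Adjacent ⟦ u ⟧ ⟦ w ⟧ → Adjacent ⟦ p ⟧ ⟦ q ⟧
    Adjacent-resp-≈ p q u w p≈u q≈w =
      Adjacent-resp (to (embed-≈⇔ u p) (≈W.sym {p} {u} p≈u)) (to (embed-≈⇔ w q) (≈W.sym {q} {w} q≈w))

  embed-E : ∀ {p q} → E Wedged p q → Adjacent ⟦ p ⟧ ⟦ q ⟧
  embed-E {p} {q} (inj₁ a , inj₁ a' , p≈u , q≈w , adj) =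
    Adjacent-resp-≈ p q (inj₁ a) (inj₁ a') p≈u q≈w (Adjacent-⊕ S₂.Mᵥ-loopless adj)
  embed-E {p} {q} (inj₂ b , inj₂ b' , p≈u , q≈w , adj) =
    Adjacent-resp-≈ p q (inj₂ b) (inj₂ b') p≈u q≈w (Side₂.Adjacent-⊕ S₁.Mᵥ-loopless adj)

  embed-E⁻ : ∀ p q → Adjacent ⟦ p ⟧ ⟦ q ⟧ → E Wedged p q
  embed-E⁻ p@(inj₁ _) q@(inj₁ _) adj = p , q , ≈W.refl {p} , ≈W.refl {q} , Adjacent-⊕⁻ S₂.Mᵥ-loopless adj
  embed-E⁻ p@(inj₂ _) q@(inj₂ _) adj = p , q , ≈W.refl {p} , ≈W.refl {q} , Side₂.Adjacent-⊕⁻ S₁.Mᵥ-loopless adj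
  embed-E⁻ p@(inj₁ (_ , A-matching , _)) q@(inj₂ (_ , B-matching , _)) adj with mixed-adjacency A-matching B-matching adj
  ... | inj₁ (A≐ , adj₂) = inj₂ S₂.Mv , q , (A≐ , ≐-refl) , ≈W.refl {q} , adj₂
  ... | inj₂ (B≐ , adj₁) = p , inj₁ S₁.Mv , ≈W.refl {p} , (B≐ , ≐-refl) , adj₁
  embed-E⁻ p@(inj₂ (_ , B-matching , _)) q@(inj₁ (_ , A-matching , _)) adj with mixed-adjacency A-matching B-matching (Adjacent-sym adj)
  ... | inj₁ (A≐ , adj₂) = p , inj₂ S₂.Mv , ≈W.refl {p} , (A≐ , ≐-refl) , Adjacent-sym adj₂
  ... | inj₂ (B≐ , adj₁) = inj₁ S₁.Mv , q , (B≐ , ≐-refl) , ≈W.refl {q} , Adjacent-sym adj₁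

  surjective : ∀ (M : V Glued) → Σ (V Wedged) λ p → ⟦ p ⟧ ≐ proj₁ M
  surjective (M , M-matching , M-size)
    with glue-point-unmatched M-matching (matching-loopless M-matching (⊕-loopless S₁.loopless S₂.loopless))
  ... | inj₁ unmatched₁ =
    inj₂ (restrict ι₂ M , restricted , from (S₂.size⇔ restricted) (D₁.restrict₂-amo M-matching amo unmatched₁)) ,
    ≐-sym (D₁.≐-Mᵥ-⊕ M-matching amo unmatched₁)
    where
    amo = to (glued-size⇔ M-matching) M-size
    restricted = Swapped.restrict-isMatching-ι₁ (S₁.loopless S₁.v) M-matching
  ... | inj₂ unmatched₂ =
    inj₁ (restrict ι₁ M , restricted , from (S₁.size⇔ restricted) (D₂.restrict₂-amo M-matching amo unmatched₂)) ,
    ≐-sym (D₂.≐-Mᵥ-⊕ M-matching amo unmatched₂)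
    where
    amo = to (glued-size⇔ M-matching) M-size
    restricted = restrict-isMatching-ι₁ (S₂.loopless S₂.v) M-matching

  isomorphism : Glued ≅ Wedged
  isomorphism = embedding⇒≅ embed (λ {p} {q} → embed-≈⇔ p q) (λ {p} {q} → mk⇔ (embed-E {p} {q}) (embed-E⁻ p q))
    (λ {M} {M'} {N} {N'} → Adjacent-resp {M = proj₁ M} {proj₁ M'} {proj₁ N} {proj₁ N'}) surjective

proposition4p7 :
    (k₁ k₂ : ℕ)
    (H₁ : Adjacency (suc (2 * k₁))) (H₂ : Adjacency (suc (2 * k₂)))
    → IsSimple H₁ → IsSimple H₂
    → (v₁ : Fin (suc (2 * k₁))) (v₂ : Fin (suc (2 * k₂)))
    → UniquelyUnmatched H₁ v₁ → UniquelyUnmatched H₂ v₂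
    → (Mv₁ : MVertex H₁ k₁) (Mv₂ : MVertex H₂ k₂)
    → Unmatched (proj₁ Mv₁) v₁ → Unmatched (proj₁ Mv₂) v₂
    → MatchingGraph (k₁ + k₂) (glue H₁ v₁ H₂ v₂)
        ≅ Wedge (MatchingGraph k₁ H₁) (MatchingGraph k₂ H₂) Mv₁ Mv₂
proposition4p7 k₁ k₂ H₁ H₂ simple₁ simple₂ v₁ v₂ unique₁ unique₂ Mv₁ Mv₂ unmatched₁ unmatched₂ =
  WedgeIsomorphism.isomorphism S₁ S₂ (glueWedging v₁ v₂) order
  where
  S₁ : UniquelyUnmatchedVertex k₁
  S₁ = record { H = H₁ ; simple = simple₁ ; v = v₁ ; unique = unique₁ ; Mv = Mv₁ ; Mv-unmatched = unmatched₁ }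
  S₂ : UniquelyUnmatchedVertex k₂
  S₂ = record { H = H₂ ; simple = simple₂ ; v = v₂ ; unique = unique₂ ; Mv = Mv₂ ; Mv-unmatched = unmatched₂ }
  order : suc (2 * k₁) + 2 * k₂ ≡ suc (2 * (k₁ + k₂))
  order = cong suc (sym (*-distribˡ-+ 2 k₁ k₂))
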